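{- Let $\Lambda\subseteq\mathbb Z^n$ be a lattice generated by $d$ vectors such that the projection $\pi:\mathbb Z^n\to\mathbb Z^d$ onto the first $d$ components is injective on $\Lambda$. For $v\in\Lambda$ let $\|v\|:=\|\pi(v)\|_1$. Let $\bar F\subseteq\Lambda$ be such that $\pi(\bar F)$ is the set of $\sqsubseteq$-minimal nonzero vectors of $\pi(\Lambda)$. Consider the algorithm: set $G:=\bar F$ and $C:=\{f+g: f,g\in G,\ \pi(f),\pi(g)\text{ lie in the same orthant of }\mathbb R^d\}$; while $C\ne\emptyset$: choose $s\in C$ of smallest norm $\|s\|$, remove it from $C$, compute $f:=\mathrm{nF}(s,G)$; if $f\ne 0$, add $f$ to $G$ and add to $C$ all $f+g$ with $g\in G$ such that $\pi(f),\pi(g)$ lie in the same orthant of $\mathbb R^d$. Return $G$. Then the set $G$ returned by this algorithm equals $\mathcal G(\Lambda)$.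
   Context: For $u,v\in\mathbb Z^m$, write $u\sqsubseteq v$ if $u^{(j)}v^{(j)}\ge 0$ and $|u^{(j)}|\le|v^{(j)}|$ for all $j$. The Graver basis $\mathcal G(\Lambda)$ is the set of all $\sqsubseteq$-minimal nonzero elements of $\Lambda$. Here the normal form is $\mathrm{nF}(s,G):=0$ if there is some $g\in G$ with $g\sqsubseteq s$, and $\mathrm{nF}(s,G):=s$ otherwise. -}

module Defs where

open import Data.Nat as ℕ using (ℕ)
open import Data.Integer as ℤ using (ℤ; 0ℤ)
open import Data.Integer.Properties as ℤP using ()
open import Data.Nat.Properties as ℕP using ()
open import Data.Vec as V using (Vec; []; _∷_)
open import Data.Vec.Properties using (≡-dec)
open import Data.Vec.Relation.Binary.Pointwise.Inductive as PW using (Pointwise)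
open import Data.List as L using (List; filter; _++_; concatMap; [_])
open import Data.List.Membership.Propositional using (_∈_)
open import Data.List.Relation.Unary.Any using (any?)
open import Data.List.Relation.Unary.All using (All)
open import Data.Product using (Σ; ∃; _×_; _,_)
open import Relation.Nullary using (¬_; Dec; yes; no; ¬?)
open import Relation.Nullary.Decidable using (_×-dec_)
open import Relation.Binary.PropositionalEquality using (_≡_; _≢_)
open import Relation.Binary.Construct.Closure.ReflexiveTransitive using (Star)

Vecℤ : ℕ → Set
Vecℤ = Vec ℤ

zeroV : ∀ {k} → Vecℤ k
zeroV = V.replicate _ 0ℤ

_+V_ : ∀ {k} → Vecℤ k → Vecℤ k → Vecℤ k
_+V_ = V.zipWith ℤ._+_

_≟V_ : ∀ {k} (u v : Vecℤ k) → Dec (u ≡ v)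
_≟V_ = ≡-dec ℤ._≟_

⊑comp : ℤ → ℤ → Set
⊑comp a b = (0ℤ ℤ.≤ a ℤ.* b) × (ℤ.∣ a ∣ ℕ.≤ ℤ.∣ b ∣)

⊑comp? : ∀ a b → Dec (⊑comp a b)
⊑comp? a b = (0ℤ ℤ.≤? a ℤ.* b) ×-dec (ℤ.∣ a ∣ ℕ.≤? ℤ.∣ b ∣)

_⊑_ : ∀ {k} → Vecℤ k → Vecℤ k → Set
_⊑_ = Pointwise ⊑comp

_⊑?_ : ∀ {k} (u v : Vecℤ k) → Dec (u ⊑ v)
_⊑?_ = PW.decidable ⊑comp?

IsMinimalNonzero : ∀ {k} → (Vecℤ k → Set) → Vecℤ k → Set
IsMinimalNonzero P v =
  P v × v ≢ zeroV × (∀ u → P u → u ≢ zeroV → u ⊑ v → u ≡ v)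

linComb : ∀ {d k} → Vec ℤ d → Vec (Vecℤ k) d → Vecℤ k
linComb []       []       = zeroV
linComb (c ∷ cs) (b ∷ bs) = V.map (c ℤ.*_) b +V linComb cs bs

InLattice : ∀ {d k} → Vec (Vecℤ k) d → Vecℤ k → Set
InLattice {d} gens v = Σ (Vec ℤ d) λ c → v ≡ linComb c gens

IsGraver : ∀ {d k} → Vec (Vecℤ k) d → Vecℤ k → Set
IsGraver gens = IsMinimalNonzero (InLattice gens)

module Algorithm (d m : ℕ) where
  -- ambient dimension n = d + m
  Vn : Set
  Vn = Vecℤ (d ℕ.+ m)

  π : Vn → Vecℤ d
  π = V.take d

  InProjLattice : Vec Vn d → Vecℤ d → Set
  InProjLattice gens w = Σ Vn λ v → InLattice gens v × π v ≡ w

  norm : Vn → ℕ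
  norm v = V.sum (V.map ℤ.∣_∣ (π v))

  SameOrthant : Vecℤ d → Vecℤ d → Set
  SameOrthant = Pointwise (λ a b → 0ℤ ℤ.≤ a ℤ.* b)

  sameOrthant? : (u v : Vecℤ d) → Dec (SameOrthant u v)
  sameOrthant? = PW.decidable (λ a b → 0ℤ ℤ.≤? a ℤ.* b)

  pairsWith : Vn → List Vn → List Vn
  pairsWith f G = L.map (f +V_) (filter (λ g → sameOrthant? (π f) (π g)) G)

  initialPairs : List Vn → List Vn
  initialPairs G = concatMap (λ f → pairsWith f G) G

  nF : Vn → List Vn → Vn
  nF s G with any? (λ g → g ⊑? s) G
  ... | yes _ = zeroV
  ... | no  _ = s

  -- remove s from C (C is a set, represented by a list)
  remove : Vn → List Vn → List Vn
  remove s C = filter (λ t → ¬? (t ≟V s)) C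

  State : Set
  State = List Vn × List Vn

  -- one iteration of the while loop (nondeterministic choice of s among
  -- the elements of C of smallest norm)
  data Step : State → State → Set where
    step-zero : ∀ {G C} s → s ∈ C → All (λ t → norm s ℕ.≤ norm t) C →
      nF s G ≡ zeroV →
      Step (G , C) (G , remove s C)
    step-add : ∀ {G C} s → s ∈ C → All (λ t → norm s ℕ.≤ norm t) C →
      nF s G ≢ zeroV →
      Step (G , C) (G ++ [ nF s G ] ,
                    remove s C ++ pairsWith (nF s G) (G ++ [ nF s G ]))

  -- G is a possible output of the algorithm started from F̄
  Returns : List Vn → List Vn → Set
  Returns Fbar G = Star Step (Fbar , initialPairs Fbar) (G , L.[])

{-# OPTIONS --safe #-}
-- G only ever receives Graver elements, and at termination it contains all of them. Both follow from
-- a completion criterion: if every sum a + b of elements of G with π a, π b in a common orthant and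
-- ‖a + b‖ < N is reduced by G (some g ∈ G has g ⊑ a + b), then so is every nonzero u ∈ Λ with ‖u‖ < N.
-- Since π is injective on Λ and π(F̄) is the Graver basis of π(Λ), u is a sum of elements of F̄ ⊆ G
-- whose projections lie in the orthant of π u. While two summands a, b are not sign-compatible in ℤⁿ,
-- replace them by some g ∈ G with g ⊑ a + b (available as ‖a + b‖ ≤ ‖u‖ < N) together with a
-- conformal decomposition of a + b − g, which exists by induction on ‖·‖; this strictly lowers the
-- total ℓ₁-norm of the summands in ℤⁿ. Once the summands are pairwise sign-compatible, each is ⊑ u.
-- The loop keeps every such pair sum either pending in C or reduced. The chosen s has minimal norm
-- among the pending sums, so the criterion holds below ‖s‖ and an irreducible s is Graver. At
-- termination C = ∅, so the criterion holds for every N, and each Graver element, being reduced by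
-- some g ∈ G, equals g.
module Submission where

open import Defs
open import Data.Nat using (ℕ)
open import Data.Vec using (Vec)
open import Data.List using (List; map)
open import Data.List.Membership.Propositional using (_∈_)
open import Data.Product using (_×_)
open import Relation.Binary.PropositionalEquality using (_≡_)

open import Algebra.Bundles using (AbelianGroup)
open import Algebra.Structures using (IsAbelianGroup)
import Algebra.Properties.AbelianGroup as AbelianGroupProperties
import Algebra.Properties.CommutativeSemigroup as CommutativeSemigroupProperties
open import Data.Empty using (⊥; ⊥-elim)
open import Data.Integer as ℤ using (ℤ; +_; +0; +[1+_]; -[1+_]; 0ℤ; ∣_∣)
import Data.Integer.Properties as ℤP
open import Data.List as L using ([]; _∷_; _++_; [_])
import Data.List.Properties as LP
open import Data.List.Membership.Propositional using (find; lose)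
open import Data.List.Membership.Propositional.Properties
  using (∈-∃++; ∈-map⁺; ∈-map⁻; ∈-++⁺ˡ; ∈-++⁺ʳ; ∈-++⁻; ∈-filter⁺; ∈-filter⁻; ∈-concatMap⁺; ∈-concatMap⁻)
open import Data.List.Relation.Binary.Permutation.Propositional
  using (_↭_; prep; ↭⇒↭ₛ) renaming (trans to ↭-trans)
import Data.List.Relation.Binary.Permutation.Propositional.Properties as ↭
open import Data.List.Relation.Binary.Permutation.Propositional.Properties
  using (shift; shifts; All-resp-↭)
open import Data.List.Relation.Binary.Permutation.Setoid.Properties using (foldr-commMonoid)
open import Data.List.Relation.Unary.All as All using (All; []; _∷_)
open import Data.List.Relation.Unary.All.Properties using (++⁺; ¬All⇒Any¬)
open import Data.List.Relation.Unary.AllPairs using (AllPairs; []; _∷_; allPairs?)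
open import Data.List.Relation.Unary.Any as Any using (Any; here; any?)
open import Data.Nat as ℕ using (zero; suc; z≤n; s≤s; _<_; _≤_)
open import Data.Nat.Induction using (<-wellFounded)
open import Data.Nat.ListAction using (sum)
open import Data.Nat.ListAction.Properties using (sum-↭; sum-++)
import Data.Nat.Properties as ℕP
open import Data.Product using (Σ-syntax; _,_; proj₁; proj₂; uncurry)
open import Data.Sum using (_⊎_; inj₁; inj₂)
open import Data.Vec as V using ([]; _∷_)
import Data.Vec.Properties as VP
open import Data.Vec.Relation.Binary.Pointwise.Inductive as PW using (Pointwise; []; _∷_)
open import Function using (_∘_)
open import Induction.WellFounded using (Acc; acc)
open import Level using (0ℓ)
open import Relation.Binary.Construct.Closure.ReflexiveTransitive using (Star; ε; _◅_)
open import Relation.Binary.Definitions using (Decidable)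
open import Relation.Binary.PropositionalEquality
  using (_≢_; refl; sym; trans; cong; cong₂; subst; subst₂; setoid; module ≡-Reasoning)
open import Relation.Binary.PropositionalEquality.Algebra using (isMagma)
open import Relation.Nullary using (¬_; ¬?; Dec; yes; no)
open import Relation.Nullary.Decidable using (map′)

module Int where

  infix 4 _≼_ _≍_ _⊴_

  data _≼_ : ℤ → ℤ → Set where
    0≼ : ∀ {b} → +0 ≼ b
    +≼+ : ∀ {p q} → p ≤ q → +[1+ p ] ≼ +[1+ q ]
    -≼- : ∀ {p q} → p ≤ q → -[1+ p ] ≼ -[1+ q ]

  data _≍_ : ℤ → ℤ → Set where
    0≍ : ∀ {b} → +0 ≍ b
    ≍0 : ∀ {a} → a ≍ +0
    +≍+ : ∀ {p q} → +[1+ p ] ≍ +[1+ q ]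
    -≍- : ∀ {p q} → -[1+ p ] ≍ -[1+ q ]

  data _⊴_ : ℤ → ℤ → Set where
    0⊴ : ∀ {t} → +0 ⊴ t
    +⊴+ : ∀ {p q} → +[1+ p ] ⊴ +[1+ q ]
    -⊴- : ∀ {p q} → -[1+ p ] ⊴ -[1+ q ]

  ⊑comp⇒≼ : ∀ {a b} → ⊑comp a b → a ≼ b
  ⊑comp⇒≼ {+0} _ = 0≼
  ⊑comp⇒≼ {+[1+ p ]} {+[1+ q ]} (_ , s≤s p≤q) = +≼+ p≤q
  ⊑comp⇒≼ { -[1+ p ]} { -[1+ q ]} (_ , s≤s p≤q) = -≼- p≤q
  ⊑comp⇒≼ {+[1+ p ]} {+0} (_ , ())
  ⊑comp⇒≼ { -[1+ p ]} {+0} (_ , ())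
  ⊑comp⇒≼ {+[1+ p ]} { -[1+ q ]} (() , _)
  ⊑comp⇒≼ { -[1+ p ]} {+[1+ q ]} (() , _)

  ≼⇒⊑comp : ∀ {a b} → a ≼ b → ⊑comp a b
  ≼⇒⊑comp 0≼ = ℤ.+≤+ z≤n , z≤n
  ≼⇒⊑comp (+≼+ p≤q) = ℤ.+≤+ z≤n , s≤s p≤q
  ≼⇒⊑comp (-≼- p≤q) = ℤ.+≤+ z≤n , s≤s p≤q

  0≤*⇒≍ : ∀ {a b} → 0ℤ ℤ.≤ a ℤ.* b → a ≍ b
  0≤*⇒≍ {+0} _ = 0≍
  0≤*⇒≍ {+[1+ p ]} {+0} _ = ≍0
  0≤*⇒≍ { -[1+ p ]} {+0} _ = ≍0
  0≤*⇒≍ {+[1+ p ]} {+[1+ q ]} _ = +≍+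
  0≤*⇒≍ { -[1+ p ]} { -[1+ q ]} _ = -≍-
  0≤*⇒≍ {+[1+ p ]} { -[1+ q ]} ()
  0≤*⇒≍ { -[1+ p ]} {+[1+ q ]} ()

  ≍⇒0≤* : ∀ {a b} → a ≍ b → 0ℤ ℤ.≤ a ℤ.* b
  ≍⇒0≤* 0≍ = ℤ.+≤+ z≤n
  ≍⇒0≤* {a} ≍0 = ℤP.≤-reflexive (sym (ℤP.*-zeroʳ a))
  ≍⇒0≤* +≍+ = ℤ.+≤+ z≤n
  ≍⇒0≤* -≍- = ℤ.+≤+ z≤n

  _≍?_ : ∀ a b → Dec (a ≍ b)
  a ≍? b = map′ 0≤*⇒≍ ≍⇒0≤* (0ℤ ℤ.≤? a ℤ.* b)

  ≼-refl : ∀ {a} → a ≼ a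
  ≼-refl {+0} = 0≼
  ≼-refl {+[1+ p ]} = +≼+ ℕP.≤-refl
  ≼-refl { -[1+ p ]} = -≼- ℕP.≤-refl

  ≼-trans : ∀ {a b c} → a ≼ b → b ≼ c → a ≼ c
  ≼-trans 0≼ _ = 0≼
  ≼-trans (+≼+ p≤q) (+≼+ q≤r) = +≼+ (ℕP.≤-trans p≤q q≤r)
  ≼-trans (-≼- p≤q) (-≼- q≤r) = -≼- (ℕP.≤-trans p≤q q≤r)

  ≼0⇒≡0 : ∀ {a} → a ≼ +0 → a ≡ +0
  ≼0⇒≡0 0≼ = refl

  ≍-+ : ∀ {a b c} → a ≍ b → a ≍ c → a ≍ b ℤ.+ c
  ≍-+ 0≍ _ = 0≍
  ≍-+ {c = c} ≍0 a≍c rewrite ℤP.+-identityˡ c = a≍c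
  ≍-+ {b = b} a≍b ≍0 rewrite ℤP.+-identityʳ b = a≍b
  ≍-+ +≍+ +≍+ = +≍+
  ≍-+ -≍- -≍- = -≍-

  a≼a+b : ∀ {a b} → a ≍ b → a ≼ a ℤ.+ b
  a≼a+b 0≍ = 0≼
  a≼a+b {a} ≍0 rewrite ℤP.+-identityʳ a = ≼-refl
  a≼a+b (+≍+ {p} {q}) = +≼+ (ℕP.m≤m+n p (suc q))
  a≼a+b (-≍- {p} {q}) = -≼- (ℕP.m≤n⇒m≤1+n (ℕP.m≤m+n p q))

  a≼c⇒a≼b+c : ∀ {a b c} → a ≼ c → b ≍ c → a ≼ b ℤ.+ c
  a≼c⇒a≼b+c 0≼ _ = 0≼
  a≼c⇒a≼b+c {c = c} a≼c 0≍ rewrite ℤP.+-identityˡ c = a≼c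
  a≼c⇒a≼b+c (+≼+ {q = q} p≤q) (+≍+ {p = r}) = +≼+ (ℕP.≤-trans p≤q (ℕP.m≤n⇒m≤o+n r (ℕP.n≤1+n q)))
  a≼c⇒a≼b+c (-≼- p≤q) (-≍- {p = r}) = -≼- (ℕP.m≤n⇒m≤1+n (ℕP.≤-trans p≤q (ℕP.m≤n+m _ r)))

  ≼⇒⊴ : ∀ {a b} → a ≼ b → a ⊴ b
  ≼⇒⊴ 0≼ = 0⊴
  ≼⇒⊴ (+≼+ _) = +⊴+
  ≼⇒⊴ (-≼- _) = -⊴-

  ⊴-trans : ∀ {a b c} → a ⊴ b → b ⊴ c → a ⊴ c
  ⊴-trans 0⊴ _ = 0⊴
  ⊴-trans +⊴+ +⊴+ = +⊴+
  ⊴-trans -⊴- -⊴- = -⊴-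

  ⊴-+ : ∀ {a b t} → a ⊴ t → b ⊴ t → a ℤ.+ b ⊴ t
  ⊴-+ {b = b} 0⊴ b⊴t rewrite ℤP.+-identityˡ b = b⊴t
  ⊴-+ {a} a⊴t 0⊴ rewrite ℤP.+-identityʳ a = a⊴t
  ⊴-+ +⊴+ +⊴+ = +⊴+
  ⊴-+ -⊴- -⊴- = -⊴-

  ⊴⇒≍ : ∀ {a b t} → a ⊴ t → b ⊴ t → a ≍ b
  ⊴⇒≍ 0⊴ _ = 0≍
  ⊴⇒≍ _ 0⊴ = ≍0
  ⊴⇒≍ +⊴+ +⊴+ = +≍+
  ⊴⇒≍ -⊴- -⊴- = -≍-

  private
    +[1+q]-+[1+p] : ∀ {p q} → p ≤ q → +[1+ q ] ℤ.- +[1+ p ] ≡ + (q ℕ.∸ p)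
    +[1+q]-+[1+p] {p} {q} p≤q = trans (ℤP.[1+m]⊖[1+n]≡m⊖n q p) (ℤP.⊖-≥ p≤q)

    -[1+q]--[1+p] : ∀ {p q} → p ≤ q → -[1+ q ] ℤ.- -[1+ p ] ≡ ℤ.- + (q ℕ.∸ p)
    -[1+q]--[1+p] {p} {q} p≤q =
      trans (ℤP.[1+m]⊖[1+n]≡m⊖n p q) (trans (ℤP.⊖-swap p q) (cong ℤ.-_ (ℤP.⊖-≥ p≤q)))

    +≼+[1+] : ∀ {k q} → k ≤ suc q → + k ≼ +[1+ q ]
    +≼+[1+] {zero} _ = 0≼
    +≼+[1+] {suc k} (s≤s k≤q) = +≼+ k≤q

    -≼-[1+] : ∀ {k q} → k ≤ suc q → ℤ.- + k ≼ -[1+ q ]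
    -≼-[1+] {zero} _ = 0≼
    -≼-[1+] {suc k} (s≤s k≤q) = -≼- k≤q

    q∸p≤1+q : ∀ p q → q ℕ.∸ p ≤ suc q
    q∸p≤1+q p q = ℕP.m≤n⇒m≤1+n (ℕP.m∸n≤m q p)

    q∸p+1+p : ∀ {p q} → p ≤ q → q ℕ.∸ p ℕ.+ suc p ≡ suc q
    q∸p+1+p {p} {q} p≤q = trans (ℕP.+-suc (q ℕ.∸ p) p) (cong suc (ℕP.m∸n+n≡m p≤q))

  b-a≼b : ∀ {a b} → a ≼ b → b ℤ.- a ≼ b
  b-a≼b {b = b} 0≼ rewrite ℤP.+-identityʳ b = ≼-refl
  b-a≼b (+≼+ {p} {q} p≤q) rewrite +[1+q]-+[1+p] p≤q = +≼+[1+] (q∸p≤1+q p q)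
  b-a≼b (-≼- {p} {q} p≤q) rewrite -[1+q]--[1+p] p≤q = -≼-[1+] (q∸p≤1+q p q)

  ∣b-a∣+∣a∣≡∣b∣ : ∀ {a b} → a ≼ b → ∣ b ℤ.- a ∣ ℕ.+ ∣ a ∣ ≡ ∣ b ∣
  ∣b-a∣+∣a∣≡∣b∣ {b = b} 0≼ rewrite ℤP.+-identityʳ b = ℕP.+-identityʳ ∣ b ∣
  ∣b-a∣+∣a∣≡∣b∣ (+≼+ p≤q) rewrite +[1+q]-+[1+p] p≤q = q∸p+1+p p≤q
  ∣b-a∣+∣a∣≡∣b∣ (-≼- {p} {q} p≤q)
    rewrite -[1+q]--[1+p] p≤q | ℤP.∣-i∣≡∣i∣ (+ (q ℕ.∸ p)) = q∸p+1+p p≤q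

  ∣a+b∣≡∣a∣+∣b∣ : ∀ {a b} → a ≍ b → ∣ a ℤ.+ b ∣ ≡ ∣ a ∣ ℕ.+ ∣ b ∣
  ∣a+b∣≡∣a∣+∣b∣ {b = b} 0≍ rewrite ℤP.+-identityˡ b = refl
  ∣a+b∣≡∣a∣+∣b∣ {a} ≍0 rewrite ℤP.+-identityʳ a = sym (ℕP.+-identityʳ ∣ a ∣)
  ∣a+b∣≡∣a∣+∣b∣ +≍+ = refl
  ∣a+b∣≡∣a∣+∣b∣ (-≍- {p} {q}) = cong suc (sym (ℕP.+-suc p q))

  ∣a+b∣<∣a∣+∣b∣ : ∀ a b → ¬ a ≍ b → ∣ a ℤ.+ b ∣ < ∣ a ∣ ℕ.+ ∣ b ∣
  ∣a+b∣<∣a∣+∣b∣ +0 _ a≭b = ⊥-elim (a≭b 0≍)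
  ∣a+b∣<∣a∣+∣b∣ +[1+ p ] +0 a≭b = ⊥-elim (a≭b ≍0)
  ∣a+b∣<∣a∣+∣b∣ -[1+ p ] +0 a≭b = ⊥-elim (a≭b ≍0)
  ∣a+b∣<∣a∣+∣b∣ +[1+ p ] +[1+ q ] a≭b = ⊥-elim (a≭b +≍+)
  ∣a+b∣<∣a∣+∣b∣ -[1+ p ] -[1+ q ] a≭b = ⊥-elim (a≭b -≍-)
  ∣a+b∣<∣a∣+∣b∣ +[1+ p ] -[1+ q ] _ =
    ℕP.≤-<-trans (ℤP.∣m⊝n∣≤m⊔n (suc p) (suc q))
      (s≤s (ℕP.≤-<-trans (ℕP.m⊔n≤m+n p q) (ℕP.+-monoʳ-< p (ℕP.n<1+n q))))
  ∣a+b∣<∣a∣+∣b∣ -[1+ p ] +[1+ q ] _ =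
    subst₂ _<_ (cong ∣_∣ (ℤP.+-comm +[1+ q ] -[1+ p ])) (ℕP.+-comm (suc q) (suc p))
      (∣a+b∣<∣a∣+∣b∣ +[1+ q ] -[1+ p ] λ ())

infix 4 _≼_ _≍_ _⊴_
_≼_ _≍_ _⊴_ : ∀ {k} → Vecℤ k → Vecℤ k → Set
_≼_ = Pointwise Int._≼_
_≍_ = Pointwise Int._≍_
-- u ⊴ t: u lies in every closed orthant containing t, i.e. in the orthant of t.
_⊴_ = Pointwise Int._⊴_

⊑⇒≼ : ∀ {k} {u v : Vecℤ k} → u ⊑ v → u ≼ v
⊑⇒≼ = PW.map Int.⊑comp⇒≼

≼⇒⊑ : ∀ {k} {u v : Vecℤ k} → u ≼ v → u ⊑ v
≼⇒⊑ = PW.map Int.≼⇒⊑comp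

0≤*⇒≍ : ∀ {k} {u v : Vecℤ k} → Pointwise (λ a b → 0ℤ ℤ.≤ a ℤ.* b) u v → u ≍ v
0≤*⇒≍ = PW.map Int.0≤*⇒≍

≍⇒0≤* : ∀ {k} {u v : Vecℤ k} → u ≍ v → Pointwise (λ a b → 0ℤ ℤ.≤ a ℤ.* b) u v
≍⇒0≤* = PW.map Int.≍⇒0≤*

_≍?_ : ∀ {k} (u v : Vecℤ k) → Dec (u ≍ v)
_≍?_ = PW.decidable Int._≍?_

infix 25 -V_
-V_ : ∀ {k} → Vecℤ k → Vecℤ k
-V_ = V.map (ℤ.-_)

-- Definitionally the group division u ∙ v ⁻¹ below, and componentwise ℤ._-_.
infix 20 _-V_
_-V_ : ∀ {k} → Vecℤ k → Vecℤ k → Vecℤ k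
u -V v = u +V (-V v)

+V-isAbelianGroup : ∀ {k} → IsAbelianGroup _≡_ (_+V_ {k}) zeroV (-V_)
+V-isAbelianGroup = record
  { isGroup = record
    { isMonoid = record
      { isSemigroup = record
        { isMagma = isMagma _+V_
        ; assoc = VP.zipWith-assoc ℤP.+-assoc
        }
      ; identity = VP.zipWith-identityˡ ℤP.+-identityˡ , VP.zipWith-identityʳ ℤP.+-identityʳ
      }
    ; inverse = VP.zipWith-inverseˡ ℤP.+-inverseˡ , VP.zipWith-inverseʳ ℤP.+-inverseʳ
    ; ⁻¹-cong = cong (-V_)
    }
  ; comm = VP.zipWith-comm ℤP.+-comm
  }

+V-abelianGroup : ℕ → AbelianGroup 0ℓ 0ℓ
+V-abelianGroup k = record { isAbelianGroup = +V-isAbelianGroup {k} }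

module _ {k : ℕ} where
  open AbelianGroup (+V-abelianGroup k) public
    using () renaming
    ( assoc to +V-assoc; comm to +V-comm
    ; identityˡ to +V-identityˡ; identityʳ to +V-identityʳ
    ; isCommutativeMonoid to +V-isCommutativeMonoid)
  open AbelianGroupProperties (+V-abelianGroup k) public
    using () renaming (⁻¹-∙-comm to -V-+V-comm; //-rightDividesˡ to [v-u]+u≡v; ε⁻¹≈ε to -V0≡0)
  open CommutativeSemigroupProperties (AbelianGroup.commutativeSemigroup (+V-abelianGroup k)) public
    using () renaming (interchange to +V-interchange)

u+[v-u]≡v : ∀ {k} (u v : Vecℤ k) → u +V (v -V u) ≡ v
u+[v-u]≡v u v = trans (+V-comm u (v -V u)) ([v-u]+u≡v u v)

≼-refl : ∀ {k} {u : Vecℤ k} → u ≼ u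
≼-refl = PW.refl Int.≼-refl

≼-trans : ∀ {k} {u v w : Vecℤ k} → u ≼ v → v ≼ w → u ≼ w
≼-trans = PW.trans Int.≼-trans

≼⇒⊴ : ∀ {k} {u v : Vecℤ k} → u ≼ v → u ⊴ v
≼⇒⊴ = PW.map Int.≼⇒⊴

⊴-trans : ∀ {k} {u v w : Vecℤ k} → u ⊴ v → v ⊴ w → u ⊴ w
⊴-trans = PW.trans Int.⊴-trans

0⊴ : ∀ {k} {t : Vecℤ k} → zeroV ⊴ t
0⊴ {t = []} = []
0⊴ {t = _ ∷ _} = Int.0⊴ ∷ 0⊴

≍0 : ∀ {k} {u : Vecℤ k} → u ≍ zeroV
≍0 {u = []} = []
≍0 {u = _ ∷ _} = Int.≍0 ∷ ≍0

≼0⇒≡0 : ∀ {k} {u : Vecℤ k} → u ≼ zeroV → u ≡ zeroV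
≼0⇒≡0 [] = refl
≼0⇒≡0 (a≼0 ∷ u≼0) = cong₂ _∷_ (Int.≼0⇒≡0 a≼0) (≼0⇒≡0 u≼0)

≍-+ : ∀ {k} {u v w : Vecℤ k} → u ≍ v → u ≍ w → u ≍ v +V w
≍-+ [] [] = []
≍-+ (p ∷ ps) (q ∷ qs) = Int.≍-+ p q ∷ ≍-+ ps qs

u≼u+v : ∀ {k} {u v : Vecℤ k} → u ≍ v → u ≼ u +V v
u≼u+v [] = []
u≼u+v (p ∷ ps) = Int.a≼a+b p ∷ u≼u+v ps

u≼w⇒u≼v+w : ∀ {k} {u v w : Vecℤ k} → u ≼ w → v ≍ w → u ≼ v +V w
u≼w⇒u≼v+w [] [] = []
u≼w⇒u≼v+w (p ∷ ps) (q ∷ qs) = Int.a≼c⇒a≼b+c p q ∷ u≼w⇒u≼v+w ps qs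

⊴-+ : ∀ {k} {u v t : Vecℤ k} → u ⊴ t → v ⊴ t → u +V v ⊴ t
⊴-+ [] [] = []
⊴-+ (p ∷ ps) (q ∷ qs) = Int.⊴-+ p q ∷ ⊴-+ ps qs

⊴⇒≍ : ∀ {k} {u v t : Vecℤ k} → u ⊴ t → v ⊴ t → u ≍ v
⊴⇒≍ [] [] = []
⊴⇒≍ (p ∷ ps) (q ∷ qs) = Int.⊴⇒≍ p q ∷ ⊴⇒≍ ps qs

v-u≼v : ∀ {k} {u v : Vecℤ k} → u ≼ v → v -V u ≼ v
v-u≼v [] = []
v-u≼v (p ∷ ps) = Int.b-a≼b p ∷ v-u≼v ps

∥_∥₁ : ∀ {k} → Vecℤ k → ℕ
∥ v ∥₁ = V.sum (V.map ∣_∣ v)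

private
  ℕ-interchange : ∀ a b c d → (a ℕ.+ b) ℕ.+ (c ℕ.+ d) ≡ (a ℕ.+ c) ℕ.+ (b ℕ.+ d)
  ℕ-interchange = CommutativeSemigroupProperties.interchange ℕP.+-commutativeSemigroup

∥0∥₁ : ∀ {k} → ∥ zeroV {k} ∥₁ ≡ 0
∥0∥₁ {zero} = refl
∥0∥₁ {suc k} = ∥0∥₁ {k}

∥∥₁≡0⇒≡0 : ∀ {k} (v : Vecℤ k) → ∥ v ∥₁ ≡ 0 → v ≡ zeroV
∥∥₁≡0⇒≡0 [] _ = refl
∥∥₁≡0⇒≡0 (a ∷ v) eq =
  cong₂ _∷_ (ℤP.∣i∣≡0⇒i≡0 (ℕP.m+n≡0⇒m≡0 ∣ a ∣ eq)) (∥∥₁≡0⇒≡0 v (ℕP.m+n≡0⇒n≡0 ∣ a ∣ eq))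

≢0⇒∥∥₁>0 : ∀ {k} {v : Vecℤ k} → v ≢ zeroV → 0 < ∥ v ∥₁
≢0⇒∥∥₁>0 {v = v} v≢0 = ℕP.n≢0⇒n>0 (v≢0 ∘ ∥∥₁≡0⇒≡0 v)

∥v-u∥₁+∥u∥₁≡∥v∥₁ : ∀ {k} {u v : Vecℤ k} → u ≼ v → ∥ v -V u ∥₁ ℕ.+ ∥ u ∥₁ ≡ ∥ v ∥₁
∥v-u∥₁+∥u∥₁≡∥v∥₁ [] = refl
∥v-u∥₁+∥u∥₁≡∥v∥₁ {u = a ∷ u} {b ∷ v} (p ∷ ps) =
  trans (ℕ-interchange (∣ b ℤ.- a ∣) (∥ v -V u ∥₁) (∣ a ∣) (∥ u ∥₁))
    (cong₂ ℕ._+_ (Int.∣b-a∣+∣a∣≡∣b∣ p) (∥v-u∥₁+∥u∥₁≡∥v∥₁ ps))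

∥u+v∥₁≡∥u∥₁+∥v∥₁ : ∀ {k} {u v : Vecℤ k} → u ≍ v → ∥ u +V v ∥₁ ≡ ∥ u ∥₁ ℕ.+ ∥ v ∥₁
∥u+v∥₁≡∥u∥₁+∥v∥₁ [] = refl
∥u+v∥₁≡∥u∥₁+∥v∥₁ {u = a ∷ u} {b ∷ v} (p ∷ ps) =
  trans (cong₂ ℕ._+_ (Int.∣a+b∣≡∣a∣+∣b∣ p) (∥u+v∥₁≡∥u∥₁+∥v∥₁ ps))
    (ℕ-interchange (∣ a ∣) (∣ b ∣) (∥ u ∥₁) (∥ v ∥₁))

∥u+v∥₁<∥u∥₁+∥v∥₁ : ∀ {k} (u v : Vecℤ k) → ¬ u ≍ v → ∥ u +V v ∥₁ < ∥ u ∥₁ ℕ.+ ∥ v ∥₁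
∥u+v∥₁<∥u∥₁+∥v∥₁ [] [] u≭v = ⊥-elim (u≭v [])
∥u+v∥₁<∥u∥₁+∥v∥₁ (a ∷ u) (b ∷ v) ab≭ = ℕP.<-≤-trans (head+tail (a Int.≍? b) (u ≍? v))
  (ℕP.≤-reflexive (ℕ-interchange (∣ a ∣) (∣ b ∣) (∥ u ∥₁) (∥ v ∥₁)))
  where
  head+tail : Dec (a Int.≍ b) → Dec (u ≍ v) →
    ∣ a ℤ.+ b ∣ ℕ.+ ∥ u +V v ∥₁ < (∣ a ∣ ℕ.+ ∣ b ∣) ℕ.+ (∥ u ∥₁ ℕ.+ ∥ v ∥₁)
  head+tail (yes a≍b) (yes u≍v) = ⊥-elim (ab≭ (a≍b ∷ u≍v))
  head+tail (yes a≍b) (no u≭v) =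
    ℕP.+-mono-≤-< (ℕP.≤-reflexive (Int.∣a+b∣≡∣a∣+∣b∣ a≍b)) (∥u+v∥₁<∥u∥₁+∥v∥₁ u v u≭v)
  head+tail (no a≭b) (yes u≍v) =
    ℕP.+-mono-<-≤ (Int.∣a+b∣<∣a∣+∣b∣ a b a≭b) (ℕP.≤-reflexive (∥u+v∥₁≡∥u∥₁+∥v∥₁ u≍v))
  head+tail (no a≭b) (no u≭v) =
    ℕP.+-mono-< (Int.∣a+b∣<∣a∣+∣b∣ a b a≭b) (∥u+v∥₁<∥u∥₁+∥v∥₁ u v u≭v)

∥v-u∥₁<∥v∥₁ : ∀ {k} {u v : Vecℤ k} → u ≢ zeroV → u ≼ v → ∥ v -V u ∥₁ < ∥ v ∥₁
∥v-u∥₁<∥v∥₁ {u = u} {v} u≢0 u≼v = begin-strict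
  ∥ v -V u ∥₁                  <⟨ ℕP.m<m+n _ (≢0⇒∥∥₁>0 u≢0) ⟩
  ∥ v -V u ∥₁ ℕ.+ ∥ u ∥₁       ≡⟨ ∥v-u∥₁+∥u∥₁≡∥v∥₁ u≼v ⟩
  ∥ v ∥₁                       ∎
  where open ℕP.≤-Reasoning

≼⇒∥∥₁≤ : ∀ {k} {u v : Vecℤ k} → u ≼ v → ∥ u ∥₁ ≤ ∥ v ∥₁
≼⇒∥∥₁≤ {u = u} {v} u≼v = begin
  ∥ u ∥₁                       ≤⟨ ℕP.m≤n+m _ _ ⟩
  ∥ v -V u ∥₁ ℕ.+ ∥ u ∥₁       ≡⟨ ∥v-u∥₁+∥u∥₁≡∥v∥₁ u≼v ⟩
  ∥ v ∥₁                       ∎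
  where open ℕP.≤-Reasoning

≼⇒∥∥₁< : ∀ {k} {u v : Vecℤ k} → u ≼ v → u ≢ v → ∥ u ∥₁ < ∥ v ∥₁
≼⇒∥∥₁< {u = u} {v} u≼v u≢v = begin-strict
  ∥ u ∥₁                       <⟨ ℕP.m<n+m _ (≢0⇒∥∥₁>0 v-u≢0) ⟩
  ∥ v -V u ∥₁ ℕ.+ ∥ u ∥₁       ≡⟨ ∥v-u∥₁+∥u∥₁≡∥v∥₁ u≼v ⟩
  ∥ v ∥₁                       ∎
  where
  open ℕP.≤-Reasoning
  v-u≢0 : v -V u ≢ zeroV
  v-u≢0 v-u≡0 = u≢v (trans (sym (trans (cong (_+V u) v-u≡0) (+V-identityˡ u))) ([v-u]+u≡v u v))

vsum : ∀ {k} → List (Vecℤ k) → Vecℤ k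
vsum = L.foldr _+V_ zeroV

Σ∥_∥₁ : ∀ {k} → List (Vecℤ k) → ℕ
Σ∥ xs ∥₁ = sum (L.map ∥_∥₁ xs)

vsum-↭ : ∀ {k} {xs ys : List (Vecℤ k)} → xs ↭ ys → vsum xs ≡ vsum ys
vsum-↭ {k} p = foldr-commMonoid (setoid (Vecℤ k)) +V-isCommutativeMonoid (↭⇒↭ₛ p)

vsum-++ : ∀ {k} (xs ys : List (Vecℤ k)) → vsum (xs ++ ys) ≡ vsum xs +V vsum ys
vsum-++ [] ys = sym (+V-identityˡ (vsum ys))
vsum-++ (x ∷ xs) ys = trans (cong (x +V_) (vsum-++ xs ys)) (sym (+V-assoc x (vsum xs) (vsum ys)))

Σ∥∥₁-↭ : ∀ {k} {xs ys : List (Vecℤ k)} → xs ↭ ys → Σ∥ xs ∥₁ ≡ Σ∥ ys ∥₁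
Σ∥∥₁-↭ p = sum-↭ (↭.map⁺ ∥_∥₁ p)

Σ∥∥₁-++ : ∀ {k} (xs ys : List (Vecℤ k)) → Σ∥ xs ++ ys ∥₁ ≡ Σ∥ xs ∥₁ ℕ.+ Σ∥ ys ∥₁
Σ∥∥₁-++ xs ys = trans (cong sum (LP.map-++ ∥_∥₁ xs ys)) (sum-++ (L.map ∥_∥₁ xs) (L.map ∥_∥₁ ys))

⊴-vsum : ∀ {k} {t : Vecℤ k} {xs} → All (_⊴ t) xs → vsum xs ⊴ t
⊴-vsum [] = 0⊴
⊴-vsum (p ∷ ps) = ⊴-+ p (⊴-vsum ps)

∥vsum∥₁≡Σ∥∥₁ : ∀ {k} {t : Vecℤ k} {xs} → All (_⊴ t) xs → ∥ vsum xs ∥₁ ≡ Σ∥ xs ∥₁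
∥vsum∥₁≡Σ∥∥₁ {k} [] = ∥0∥₁ {k}
∥vsum∥₁≡Σ∥∥₁ {xs = x ∷ xs} (p ∷ ps) =
  trans (∥u+v∥₁≡∥u∥₁+∥v∥₁ (⊴⇒≍ p (⊴-vsum ps))) (cong (∥ x ∥₁ ℕ.+_) (∥vsum∥₁≡Σ∥∥₁ ps))

≍-vsum : ∀ {k} {u : Vecℤ k} {xs} → All (u ≍_) xs → u ≍ vsum xs
≍-vsum [] = ≍0
≍-vsum (p ∷ ps) = ≍-+ p (≍-vsum ps)

pairwise⇒conformal : ∀ {k} {xs : List (Vecℤ k)} → AllPairs _≍_ xs → All (_≼ vsum xs) xs
pairwise⇒conformal [] = []
pairwise⇒conformal (x≍xs ∷ xs-pairwise) =
  u≼u+v (≍-vsum x≍xs) ∷ All.map (λ y≼ → u≼w⇒u≼v+w y≼ (≍-vsum x≍xs)) (pairwise⇒conformal xs-pairwise)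

incompatible-pair : ∀ {A : Set} {R : A → A → Set} → Decidable R → ∀ xs → ¬ AllPairs R xs →
  Σ[ a ∈ A ] Σ[ b ∈ A ] Σ[ rest ∈ List A ] (xs ↭ a ∷ b ∷ rest) × ¬ R a b
incompatible-pair R? [] ¬pairwise = ⊥-elim (¬pairwise [])
incompatible-pair R? (x ∷ xs) ¬pairwise with All.all? (R? x) xs
... | no ¬x-xs with find (¬All⇒Any¬ (R? x) xs ¬x-xs)
...   | y , y∈xs , ¬xRy with ∈-∃++ y∈xs
...     | ys , zs , refl = x , y , ys ++ zs , prep x (shift y ys zs) , ¬xRy
incompatible-pair R? (x ∷ xs) ¬pairwise | yes x-xs
  with incompatible-pair R? xs (¬pairwise ∘ (x-xs ∷_))
... | a , b , rest , xs↭ , ¬aRb =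
  a , b , x ∷ rest , ↭-trans (prep x xs↭) (shifts [ x ] (a ∷ b ∷ [])) , ¬aRb

merge-vsum : ∀ {k} {a b : Vecℤ k} {ks rest} → vsum ks ≡ a +V b → vsum (ks ++ rest) ≡ vsum (a ∷ b ∷ rest)
merge-vsum {a = a} {b} {ks} {rest} Σks≡a+b = begin
  vsum (ks ++ rest)        ≡⟨ vsum-++ ks rest ⟩
  vsum ks +V vsum rest     ≡⟨ cong (_+V vsum rest) Σks≡a+b ⟩
  (a +V b) +V vsum rest    ≡⟨ +V-assoc a b (vsum rest) ⟩
  vsum (a ∷ b ∷ rest)      ∎
  where open ≡-Reasoning

merge-Σ∥∥₁< : ∀ {k} {a b : Vecℤ k} {ks rest} → ¬ a ≍ b → All (_≼ a +V b) ks → vsum ks ≡ a +V b →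
  Σ∥ ks ++ rest ∥₁ < Σ∥ a ∷ b ∷ rest ∥₁
merge-Σ∥∥₁< {a = a} {b} {ks} {rest} a≭b ks≼a+b Σks≡a+b = begin-strict
  Σ∥ ks ++ rest ∥₁                      ≡⟨ Σ∥∥₁-++ ks rest ⟩
  Σ∥ ks ∥₁ ℕ.+ Σ∥ rest ∥₁               ≡⟨ cong (ℕ._+ Σ∥ rest ∥₁) Σ∥ks∥₁≡∥a+b∥₁ ⟩
  ∥ a +V b ∥₁ ℕ.+ Σ∥ rest ∥₁            <⟨ ℕP.+-monoˡ-< Σ∥ rest ∥₁ (∥u+v∥₁<∥u∥₁+∥v∥₁ a b a≭b) ⟩
  (∥ a ∥₁ ℕ.+ ∥ b ∥₁) ℕ.+ Σ∥ rest ∥₁    ≡⟨ ℕP.+-assoc ∥ a ∥₁ ∥ b ∥₁ Σ∥ rest ∥₁ ⟩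
  Σ∥ a ∷ b ∷ rest ∥₁                    ∎
  where
  open ℕP.≤-Reasoning
  Σ∥ks∥₁≡∥a+b∥₁ : Σ∥ ks ∥₁ ≡ ∥ a +V b ∥₁
  Σ∥ks∥₁≡∥a+b∥₁ = trans (sym (∥vsum∥₁≡Σ∥∥₁ (All.map ≼⇒⊴ ks≼a+b))) (cong ∥_∥₁ Σks≡a+b)

Decomposition : ∀ {k} → List (Vecℤ k) → (Vecℤ k → Set) → Vecℤ k → Set
Decomposition {k} G R u = Σ[ gs ∈ List (Vecℤ k) ] All (_∈ G) gs × All R gs × vsum gs ≡ u

Decomposition-⊆ : ∀ {k} {G G′ : List (Vecℤ k)} {R u} → (∀ {g} → g ∈ G → g ∈ G′) →
  Decomposition G R u → Decomposition G′ R u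
Decomposition-⊆ G⊆G′ (gs , gs⊆G , Rgs , Σgs≡u) = gs , All.map G⊆G′ gs⊆G , Rgs , Σgs≡u

∷-decomposition : ∀ {k} {G : List (Vecℤ k)} {R R′ : Vecℤ k → Set} {g u} → (∀ {h} → R′ h → R h) →
  g ∈ G → R g → Decomposition G R′ (u -V g) → Decomposition G R u
∷-decomposition {g = g} {u} R′⇒R g∈G Rg (gs , gs⊆G , R′gs , Σgs≡u-g) =
  g ∷ gs , g∈G ∷ gs⊆G , Rg ∷ All.map R′⇒R R′gs , trans (cong (g +V_) Σgs≡u-g) (u+[v-u]≡v g u)

linComb-+ : ∀ {d k} (c c′ : Vecℤ d) (gs : Vec (Vecℤ k) d) →
  linComb (c +V c′) gs ≡ linComb c gs +V linComb c′ gs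
linComb-+ [] [] [] = sym (+V-identityˡ zeroV)
linComb-+ (x ∷ c) (y ∷ c′) (g ∷ gs) = begin
  V.map ((x ℤ.+ y) ℤ.*_) g +V linComb (c +V c′) gs
    ≡⟨ cong₂ _+V_ (map-*-distribʳ-+ g) (linComb-+ c c′ gs) ⟩
  (V.map (x ℤ.*_) g +V V.map (y ℤ.*_) g) +V (linComb c gs +V linComb c′ gs)
    ≡⟨ +V-interchange _ _ _ _ ⟩
  (V.map (x ℤ.*_) g +V linComb c gs) +V (V.map (y ℤ.*_) g +V linComb c′ gs)
    ∎
  where
  open ≡-Reasoning
  map-*-distribʳ-+ : ∀ {k} (g : Vecℤ k) → V.map ((x ℤ.+ y) ℤ.*_) g ≡ V.map (x ℤ.*_) g +V V.map (y ℤ.*_) g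
  map-*-distribʳ-+ [] = refl
  map-*-distribʳ-+ (z ∷ g) = cong₂ _∷_ (ℤP.*-distribʳ-+ z x y) (map-*-distribʳ-+ g)

linComb-neg : ∀ {d k} (c : Vecℤ d) (gs : Vec (Vecℤ k) d) → linComb (-V c) gs ≡ -V linComb c gs
linComb-neg [] [] = sym -V0≡0
linComb-neg (x ∷ c) (g ∷ gs) = begin
  V.map ((ℤ.- x) ℤ.*_) g +V linComb (-V c) gs
    ≡⟨ cong₂ _+V_ (map-neg-* g) (linComb-neg c gs) ⟩
  -V V.map (x ℤ.*_) g +V -V linComb c gs
    ≡⟨ -V-+V-comm _ _ ⟩
  -V (V.map (x ℤ.*_) g +V linComb c gs)
    ∎
  where
  open ≡-Reasoning
  map-neg-* : ∀ {k} (g : Vecℤ k) → V.map ((ℤ.- x) ℤ.*_) g ≡ -V V.map (x ℤ.*_) g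
  map-neg-* [] = refl
  map-neg-* (z ∷ g) = cong₂ _∷_ (sym (ℤP.neg-distribˡ-* x z)) (map-neg-* g)

linComb-0 : ∀ {d k} (gs : Vec (Vecℤ k) d) → linComb zeroV gs ≡ zeroV
linComb-0 [] = refl
linComb-0 (g ∷ gs) = trans (cong₂ _+V_ (VP.map-const g 0ℤ) (linComb-0 gs)) (+V-identityˡ zeroV)

module _ {d k} {gens : Vec (Vecℤ k) d} where

  Λ-0 : InLattice gens zeroV
  Λ-0 = zeroV , sym (linComb-0 gens)

  Λ-+ : ∀ {u v} → InLattice gens u → InLattice gens v → InLattice gens (u +V v)
  Λ-+ (c , refl) (c′ , refl) = c +V c′ , sym (linComb-+ c c′ gens)

  Λ-- : ∀ {u v} → InLattice gens u → InLattice gens v → InLattice gens (u -V v)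
  Λ-- Λu (c′ , refl) = Λ-+ Λu (-V c′ , sym (linComb-neg c′ gens))

minimal-below : ∀ {k} {P : Vecℤ k → Set} (M : List (Vecℤ k)) →
  (∀ w → IsMinimalNonzero P w → w ∈ M) →
  ∀ {v} → P v → v ≢ zeroV → Σ[ f ∈ Vecℤ k ] f ∈ M × f ≼ v
minimal-below {P = P} M minimal∈M {v} Pv v≢0 with any? (_⊑? v) M
... | yes M⊑v = let f , f∈M , f⊑v = find M⊑v in f , f∈M , ⊑⇒≼ f⊑v
... | no M⋢v = ⊥-elim (below-nothing (<-wellFounded ∥ v ∥₁) Pv v≢0 M⋢v)
  where
  -- If nothing in M lies below w, then w is minimal (a smaller nonzero element of P would, by
  -- induction on the norm, have nothing of M below it either), so w ∈ M after all.
  below-nothing : ∀ {w} → Acc _<_ ∥ w ∥₁ → P w → w ≢ zeroV → ¬ Any (_⊑ w) M → ⊥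
  below-nothing {w} (acc smaller) Pw w≢0 M⋢w =
    M⋢w (lose (minimal∈M w (Pw , w≢0 , minimal)) (≼⇒⊑ ≼-refl))
    where
    minimal : ∀ u → P u → u ≢ zeroV → u ⊑ w → u ≡ w
    minimal u Pu u≢0 u⊑w with u ≟V w
    ... | yes u≡w = u≡w
    ... | no u≢w = ⊥-elim (below-nothing (smaller (≼⇒∥∥₁< (⊑⇒≼ u⊑w) u≢w)) Pu u≢0
      (M⋢w ∘ Any.map (λ f⊑u → ≼⇒⊑ (≼-trans (⊑⇒≼ f⊑u) (⊑⇒≼ u⊑w)))))

take⁺ : ∀ {R : ℤ → ℤ → Set} d {m} {u v : Vecℤ (d ℕ.+ m)} →
  Pointwise R u v → Pointwise R (V.take d u) (V.take d v)
take⁺ zero _ = []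
take⁺ (suc d) (p ∷ ps) = p ∷ take⁺ d ps

module Completion
  (d m : ℕ) (gens : Vec (Algorithm.Vn d m) d)
  (π-injective : ∀ u v → InLattice gens u → InLattice gens v →
    Algorithm.π d m u ≡ Algorithm.π d m v → u ≡ v)
  (Fbar : List (Algorithm.Vn d m))
  (Fbar⊆Λ : ∀ f → f ∈ Fbar → InLattice gens f)
  (πFbar-minimal : ∀ w → (w ∈ map (Algorithm.π d m) Fbar →
      IsMinimalNonzero (Algorithm.InProjLattice d m gens) w)
    × (IsMinimalNonzero (Algorithm.InProjLattice d m gens) w →
      w ∈ map (Algorithm.π d m) Fbar))
  where

  open Algorithm d m

  Λ : Vn → Set
  Λ = InLattice gens

  π-+ : ∀ u v → π (u +V v) ≡ π u +V π v
  π-+ = VP.take-zipWith ℤ._+_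

  π-- : ∀ u v → π (u -V v) ≡ π u -V π v
  π-- u v = trans (π-+ u (-V v)) (cong (π u +V_) (VP.take-map ℤ.-_ d v))

  π-0 : π zeroV ≡ zeroV
  π-0 = take-replicate d
    where
    take-replicate : ∀ d {m} → V.take d (zeroV {d ℕ.+ m}) ≡ zeroV
    take-replicate zero = refl
    take-replicate (suc d) = cong (0ℤ ∷_) (take-replicate d)

  π-mono-≼ : ∀ {u v} → u ≼ v → π u ≼ π v
  π-mono-≼ = take⁺ d

  π-vsum-⊴ : ∀ {t xs} → All (λ h → π h ⊴ t) xs → π (vsum xs) ⊴ t
  π-vsum-⊴ [] = subst (_⊴ _) (sym π-0) 0⊴
  π-vsum-⊴ {xs = x ∷ xs} (πx⊴ ∷ πxs⊴) =
    subst (_⊴ _) (sym (π-+ x (vsum xs))) (⊴-+ πx⊴ (π-vsum-⊴ πxs⊴))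

  π-nonzero : ∀ {u} → Λ u → u ≢ zeroV → π u ≢ zeroV
  π-nonzero {u} Λu u≢0 πu≡0 = u≢0 (π-injective u zeroV Λu Λ-0 (trans πu≡0 (sym π-0)))

  πminimal⇒graver : ∀ {f} → Λ f → IsMinimalNonzero (InProjLattice gens) (π f) → IsGraver gens f
  πminimal⇒graver {f} Λf (_ , πf≢0 , πf-minimal) = Λf , f≢0 , f-minimal
    where
    f≢0 : f ≢ zeroV
    f≢0 f≡0 = πf≢0 (trans (cong π f≡0) π-0)
    f-minimal : ∀ h → Λ h → h ≢ zeroV → h ⊑ f → h ≡ f
    f-minimal h Λh h≢0 h⊑f = π-injective h f Λh Λf
      (πf-minimal (π h) (h , Λh , refl) (π-nonzero Λh h≢0) (≼⇒⊑ (π-mono-≼ (⊑⇒≼ h⊑f))))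

  Fbar-graver : ∀ {f} → f ∈ Fbar → IsGraver gens f
  Fbar-graver {f} f∈Fbar =
    πminimal⇒graver (Fbar⊆Λ f f∈Fbar) (proj₁ (πFbar-minimal (π f)) (∈-map⁺ π f∈Fbar))

  Fbar-below : ∀ {u} → Λ u → u ≢ zeroV → Σ[ f ∈ Vn ] f ∈ Fbar × π f ≼ π u
  Fbar-below {u} Λu u≢0
    with minimal-below (L.map π Fbar) (λ w → proj₂ (πFbar-minimal w)) (u , Λu , refl) (π-nonzero Λu u≢0)
  ... | w , w∈πFbar , w≼πu with ∈-map⁻ π w∈πFbar
  ... | f , f∈Fbar , refl = f , f∈Fbar , w≼πu

  norm[u-g]<norm[u] : ∀ {g u} → IsGraver gens g → π g ≼ π u → norm (u -V g) < norm u
  norm[u-g]<norm[u] {g} {u} (Λg , g≢0 , _) πg≼πu =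
    subst (_< norm u) (cong ∥_∥₁ (sym (π-- u g))) (∥v-u∥₁<∥v∥₁ (π-nonzero Λg g≢0) πg≼πu)

  OrthantDecomposition ConformalDecomposition : List Vn → Vn → Set
  OrthantDecomposition G u = Decomposition G (λ g → π g ⊴ π u) u
  ConformalDecomposition G u = Decomposition G (_≼ u) u

  Fbar-decomposition : ∀ {u} → Acc _<_ (norm u) → Λ u → OrthantDecomposition Fbar u
  Fbar-decomposition {u} (acc smaller) Λu with u ≟V zeroV
  ... | yes refl = [] , [] , [] , refl
  ... | no u≢0 with Fbar-below Λu u≢0
  ... | f , f∈Fbar , πf≼πu = ∷-decomposition (λ πh⊴ → ⊴-trans πh⊴ πu-f⊴πu) f∈Fbar (≼⇒⊴ πf≼πu)
    (Fbar-decomposition (smaller (norm[u-g]<norm[u] (Fbar-graver f∈Fbar) πf≼πu))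
      (Λ-- Λu (Fbar⊆Λ f f∈Fbar)))
    where
    πu-f⊴πu : π (u -V f) ⊴ π u
    πu-f⊴πu = subst (_⊴ π u) (sym (π-- u f)) (≼⇒⊴ (v-u≼v πf≼πu))

  π[a+b]≼πu : ∀ {u a b rest} → All (λ h → π h ⊴ π u) (a ∷ b ∷ rest) → vsum (a ∷ b ∷ rest) ≡ u →
    π (a +V b) ≼ π u
  π[a+b]≼πu {u} {a} {b} {rest} (πa⊴ ∷ πb⊴ ∷ rest⊴) Σ≡u =
    subst (π (a +V b) ≼_) πu≡ (u≼u+v (⊴⇒≍ πa+b⊴ (π-vsum-⊴ rest⊴)))
    where
    πa+b⊴ : π (a +V b) ⊴ π u
    πa+b⊴ = subst (_⊴ π u) (sym (π-+ a b)) (⊴-+ πa⊴ πb⊴)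
    πu≡ : π (a +V b) +V π (vsum rest) ≡ π u
    πu≡ = trans (sym (π-+ (a +V b) (vsum rest))) (cong π (trans (+V-assoc a b (vsum rest)) Σ≡u))

  Reducible : List Vn → Vn → Set
  Reducible G v = Σ[ g ∈ Vn ] g ∈ G × g ≼ v

  PairsReducedBelow : ℕ → List Vn → Set
  PairsReducedBelow N G = ∀ {a b} → a ∈ G → b ∈ G → SameOrthant (π a) (π b) → norm (a +V b) < N →
    Reducible G (a +V b)

  module Criterion {G : List Vn} (G-graver : ∀ {g} → g ∈ G → IsGraver gens g)
    (Fbar⊆G : ∀ {f} → f ∈ Fbar → f ∈ G) {N : ℕ} (reduced : PairsReducedBelow N G) where

    SmallerDecomposable : Vn → Set
    SmallerDecomposable u = ∀ {v} → Λ v → norm v < norm u → ConformalDecomposition G v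

    pair-conformal-decomposition : ∀ {u a b} → a ∈ G → b ∈ G → SameOrthant (π a) (π b) →
      π (a +V b) ≼ π u → norm u < N → SmallerDecomposable u → ConformalDecomposition G (a +V b)
    pair-conformal-decomposition a∈G b∈G πa∼πb πa+b≼πu u<N IH
      with reduced a∈G b∈G πa∼πb (ℕP.≤-<-trans (≼⇒∥∥₁≤ πa+b≼πu) u<N)
    ... | g , g∈G , g≼a+b = ∷-decomposition (λ h≼ → ≼-trans h≼ (v-u≼v g≼a+b)) g∈G g≼a+b
      (IH (Λ-- (Λ-+ (Λ-of a∈G) (Λ-of b∈G)) (Λ-of g∈G))
          (ℕP.<-≤-trans (norm[u-g]<norm[u] (G-graver g∈G) (π-mono-≼ g≼a+b)) (≼⇒∥∥₁≤ πa+b≼πu)))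
      where
      Λ-of : ∀ {h} → h ∈ G → Λ h
      Λ-of = proj₁ ∘ G-graver

    merge-incompatible-pair : ∀ {u a b rest} → norm u < N → SmallerDecomposable u →
      All (_∈ G) (a ∷ b ∷ rest) → All (λ h → π h ⊴ π u) (a ∷ b ∷ rest) → vsum (a ∷ b ∷ rest) ≡ u →
      ¬ a ≍ b → Σ[ D ∈ OrthantDecomposition G u ] Σ∥ proj₁ D ∥₁ < Σ∥ a ∷ b ∷ rest ∥₁
    merge-incompatible-pair {u} {a} {b} {rest} u<N IH
      (a∈G ∷ b∈G ∷ rest⊆G) ab⊴@(πa⊴ ∷ πb⊴ ∷ rest⊴) Σ≡u a≭b
      with pair-conformal-decomposition a∈G b∈G (≍⇒0≤* (⊴⇒≍ πa⊴ πb⊴)) (π[a+b]≼πu ab⊴ Σ≡u) u<N IH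
    ... | ks , ks⊆G , ks≼a+b , Σks≡a+b =
      ( ks ++ rest , ++⁺ ks⊆G rest⊆G , ++⁺ (All.map πh⊴πu ks≼a+b) rest⊴
      , trans (merge-vsum {ks = ks} {rest} Σks≡a+b) Σ≡u)
      , merge-Σ∥∥₁< a≭b ks≼a+b Σks≡a+b
      where
      πh⊴πu : ∀ {h} → h ≼ a +V b → π h ⊴ π u
      πh⊴πu h≼a+b = ≼⇒⊴ (≼-trans (π-mono-≼ h≼a+b) (π[a+b]≼πu ab⊴ Σ≡u))

    orthant⇒conformal-decomposition : ∀ {u} → norm u < N → SmallerDecomposable u →
      (D : OrthantDecomposition G u) → Acc _<_ Σ∥ proj₁ D ∥₁ → ConformalDecomposition G u
    orthant⇒conformal-decomposition u<N IH (gs , gs⊆G , gs⊴ , Σgs≡u) (acc smaller)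
      with allPairs? _≍?_ gs
    ... | yes pairwise =
      gs , gs⊆G , subst (λ t → All (_≼ t) gs) Σgs≡u (pairwise⇒conformal pairwise) , Σgs≡u
    ... | no ¬pairwise with incompatible-pair _≍?_ gs ¬pairwise
    ... | a , b , rest , gs↭ , a≭b
      with merge-incompatible-pair u<N IH (All-resp-↭ gs↭ gs⊆G) (All-resp-↭ gs↭ gs⊴)
             (trans (sym (vsum-↭ gs↭)) Σgs≡u) a≭b
    ... | D , D<gs = orthant⇒conformal-decomposition u<N IH D
      (smaller (subst (Σ∥ proj₁ D ∥₁ <_) (sym (Σ∥∥₁-↭ gs↭)) D<gs))

    conformal-decomposition : ∀ {u} → Acc _<_ (norm u) → Λ u → norm u < N → ConformalDecomposition G u
    conformal-decomposition {u} (acc smaller) Λu u<N = orthant⇒conformal-decomposition u<N IH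
      (Decomposition-⊆ Fbar⊆G (Fbar-decomposition (<-wellFounded (norm u)) Λu)) (<-wellFounded _)
      where
      IH : SmallerDecomposable u
      IH Λv v<u = conformal-decomposition (smaller v<u) Λv (ℕP.<-trans v<u u<N)

    small⇒reducible : ∀ {u} → Λ u → u ≢ zeroV → norm u < N → Reducible G u
    small⇒reducible Λu u≢0 u<N with conformal-decomposition (<-wellFounded _) Λu u<N
    ... | [] , _ , _ , Σ≡u = ⊥-elim (u≢0 (sym Σ≡u))
    ... | g ∷ _ , g∈G ∷ _ , g≼u ∷ _ , _ = g , g∈G , g≼u

  nF≡0⇒reducible : ∀ {s G} → s ≢ zeroV → nF s G ≡ zeroV → Reducible G s
  nF≡0⇒reducible {s} {G} s≢0 nF≡0 with any? (λ g → g ⊑? s) G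
  ... | yes G⊑s = let g , g∈G , g⊑s = find G⊑s in g , g∈G , ⊑⇒≼ g⊑s
  ... | no _ = ⊥-elim (s≢0 nF≡0)

  nF≢0⇒irreducible : ∀ {s G} → nF s G ≢ zeroV → nF s G ≡ s × ¬ Any (_⊑ s) G
  nF≢0⇒irreducible {s} {G} nF≢0 with any? (λ g → g ⊑? s) G
  ... | yes _ = ⊥-elim (nF≢0 refl)
  ... | no G⋢s = refl , G⋢s

  ∈-pairsWith⁺ : ∀ {f g G} → g ∈ G → SameOrthant (π f) (π g) → f +V g ∈ pairsWith f G
  ∈-pairsWith⁺ {f} g∈G πf∼πg = ∈-map⁺ (f +V_) (∈-filter⁺ (λ g → sameOrthant? (π f) (π g)) g∈G πf∼πg)

  ∈-pairsWith⁻ : ∀ {c f G} → c ∈ pairsWith f G → Σ[ g ∈ Vn ] g ∈ G × c ≡ f +V g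
  ∈-pairsWith⁻ {f = f} c∈ with ∈-map⁻ (f +V_) c∈
  ... | g , g∈ , c≡f+g = g , proj₁ (∈-filter⁻ (λ g → sameOrthant? (π f) (π g)) g∈) , c≡f+g

  ∈-remove⁻ : ∀ {t s C} → t ∈ remove s C → t ∈ C
  ∈-remove⁻ {s = s} t∈ = proj₁ (∈-filter⁻ (λ t → ¬? (t ≟V s)) t∈)

  ∈-remove : ∀ {t s C} → t ∈ C → t ≡ s ⊎ t ∈ remove s C
  ∈-remove {t} {s} t∈C with t ≟V s
  ... | yes t≡s = inj₁ t≡s
  ... | no t≢s = inj₂ (∈-filter⁺ (λ t → ¬? (t ≟V s)) t∈C t≢s)

  sameOrthant-sym : ∀ {u v : Vecℤ d} → SameOrthant u v → SameOrthant v u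
  sameOrthant-sym = PW.sym (λ {a} {b} → subst (0ℤ ℤ.≤_) (ℤP.*-comm a b))

  a+b≢0 : ∀ {a b} → IsGraver gens a → SameOrthant (π a) (π b) → a +V b ≢ zeroV
  a+b≢0 {a} {b} (Λa , a≢0 , _) πa∼πb a+b≡0 = π-nonzero Λa a≢0 (≼0⇒≡0 πa≼0)
    where
    πa≼0 : π a ≼ zeroV
    πa≼0 = subst (π a ≼_) (trans (sym (π-+ a b)) (trans (cong π a+b≡0) π-0)) (u≼u+v (0≤*⇒≍ πa∼πb))

  record Invariant (G C : List Vn) : Set where
    field
      graver : ∀ {g} → g ∈ G → IsGraver gens g
      pending⊆Λ : ∀ {c} → c ∈ C → Λ c
      Fbar⊆G : ∀ {f} → f ∈ Fbar → f ∈ G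
      pairs : ∀ {a b} → a ∈ G → b ∈ G → SameOrthant (π a) (π b) → a +V b ∈ C ⊎ Reducible G (a +V b)

  invariant⇒reduced-below : ∀ {G C N} → Invariant G C → All (λ t → N ≤ norm t) C → PairsReducedBelow N G
  invariant⇒reduced-below inv C≥N a∈G b∈G πa∼πb a+b<N with Invariant.pairs inv a∈G b∈G πa∼πb
  ... | inj₁ a+b∈C = ⊥-elim (ℕP.<⇒≱ a+b<N (All.lookup C≥N a+b∈C))
  ... | inj₂ a+b-reducible = a+b-reducible

  irreducible⇒graver : ∀ {G C s} → Invariant G C → s ∈ C → All (λ t → norm s ≤ norm t) C →
    ¬ Any (_⊑ s) G → s ≢ zeroV → IsGraver gens s
  irreducible⇒graver {G} {s = s} inv s∈C s-min irreducible s≢0 = Λs , s≢0 , minimal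
    where
    open Invariant inv
    open Criterion graver Fbar⊆G (invariant⇒reduced-below inv s-min)
    Λs : Λ s
    Λs = pending⊆Λ s∈C
    minimal : ∀ h → Λ h → h ≢ zeroV → h ⊑ s → h ≡ s
    minimal h Λh h≢0 h⊑s with h ≟V s
    ... | yes h≡s = h≡s
    ... | no h≢s with small⇒reducible Λh h≢0 (≼⇒∥∥₁< (π-mono-≼ (⊑⇒≼ h⊑s)) (h≢s ∘ π-injective h s Λh Λs))
    ... | g , g∈G , g≼h = ⊥-elim (irreducible (lose g∈G (≼⇒⊑ (≼-trans g≼h (⊑⇒≼ h⊑s)))))

  initial-invariant : Invariant Fbar (initialPairs Fbar)
  initial-invariant = record
    { graver = Fbar-graver
    ; pending⊆Λ = pending⊆Λ
    ; Fbar⊆G = λ f∈Fbar → f∈Fbar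
    ; pairs = λ a∈ b∈ πa∼πb →
        inj₁ (∈-concatMap⁺ (λ f → pairsWith f Fbar) (lose a∈ (∈-pairsWith⁺ b∈ πa∼πb)))
    }
    where
    pending⊆Λ : ∀ {c} → c ∈ initialPairs Fbar → Λ c
    pending⊆Λ c∈ with find (∈-concatMap⁻ (λ f → pairsWith f Fbar) c∈)
    ... | f , f∈ , c∈pairs with ∈-pairsWith⁻ c∈pairs
    ... | g , g∈ , refl = Λ-+ (Fbar⊆Λ f f∈) (Fbar⊆Λ g g∈)

  discard-preserves : ∀ {G C s} → s ∈ C → nF s G ≡ zeroV → Invariant G C → Invariant G (remove s C)
  discard-preserves {G} {C} {s} s∈C nF≡0 inv = record
    { graver = graver
    ; pending⊆Λ = pending⊆Λ ∘ ∈-remove⁻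
    ; Fbar⊆G = Fbar⊆G
    ; pairs = pairs′
    }
    where
    open Invariant inv
    pairs′ : ∀ {a b} → a ∈ G → b ∈ G → SameOrthant (π a) (π b) →
      a +V b ∈ remove s C ⊎ Reducible G (a +V b)
    pairs′ a∈G b∈G πa∼πb with pairs a∈G b∈G πa∼πb
    ... | inj₂ a+b-reducible = inj₂ a+b-reducible
    ... | inj₁ a+b∈C with ∈-remove {s = s} a+b∈C
    ...   | inj₁ refl = inj₂ (nF≡0⇒reducible (a+b≢0 (graver a∈G) πa∼πb) nF≡0)
    ...   | inj₂ a+b∈C′ = inj₁ a+b∈C′

  add-preserves : ∀ {G C s} → s ∈ C → All (λ t → norm s ≤ norm t) C → ¬ Any (_⊑ s) G → s ≢ zeroV →
    Invariant G C → Invariant (G ++ [ s ]) (remove s C ++ pairsWith s (G ++ [ s ]))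
  add-preserves {G} {C} {s} s∈C s-min irreducible s≢0 inv = record
    { graver = graver′
    ; pending⊆Λ = pending⊆Λ′
    ; Fbar⊆G = ∈-++⁺ˡ ∘ Fbar⊆G
    ; pairs = pairs′
    }
    where
    open Invariant inv
    G′ C′ : List Vn
    G′ = G ++ [ s ]
    C′ = remove s C ++ pairsWith s G′
    s∈G′ : s ∈ G′
    s∈G′ = ∈-++⁺ʳ G (here refl)
    graver′ : ∀ {g} → g ∈ G′ → IsGraver gens g
    graver′ g∈G′ with ∈-++⁻ G g∈G′
    ... | inj₁ g∈G = graver g∈G
    ... | inj₂ (here refl) = irreducible⇒graver inv s∈C s-min irreducible s≢0
    pending⊆Λ′ : ∀ {c} → c ∈ C′ → Λ c
    pending⊆Λ′ c∈C′ with ∈-++⁻ (remove s C) c∈C′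
    ... | inj₁ c∈C = pending⊆Λ (∈-remove⁻ c∈C)
    ... | inj₂ c∈pairs with ∈-pairsWith⁻ c∈pairs
    ...   | g , g∈G′ , refl = Λ-+ (pending⊆Λ s∈C) (proj₁ (graver′ g∈G′))
    pairs′ : ∀ {a b} → a ∈ G′ → b ∈ G′ → SameOrthant (π a) (π b) → a +V b ∈ C′ ⊎ Reducible G′ (a +V b)
    pairs′ a∈G′ b∈G′ πa∼πb with ∈-++⁻ G a∈G′ | ∈-++⁻ G b∈G′
    ... | inj₂ (here refl) | _ = inj₁ (∈-++⁺ʳ (remove s C) (∈-pairsWith⁺ b∈G′ πa∼πb))
    ... | inj₁ _ | inj₂ (here refl) = inj₁ (subst (_∈ C′) (+V-comm s _)
      (∈-++⁺ʳ (remove s C) (∈-pairsWith⁺ a∈G′ (sameOrthant-sym πa∼πb))))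
    ... | inj₁ a∈G | inj₁ b∈G with pairs a∈G b∈G πa∼πb
    ...   | inj₂ (g , g∈G , g≼a+b) = inj₂ (g , ∈-++⁺ˡ g∈G , g≼a+b)
    ...   | inj₁ a+b∈C with ∈-remove {s = s} a+b∈C
    ...     | inj₁ refl = inj₂ (s , s∈G′ , ≼-refl)
    ...     | inj₂ a+b∈C′ = inj₁ (∈-++⁺ˡ a+b∈C′)

  step-preserves : ∀ {S T} → Step S T → uncurry Invariant S → uncurry Invariant T
  step-preserves (step-zero s s∈C _ nF≡0) = discard-preserves s∈C nF≡0
  step-preserves {G , C} (step-add s s∈C s-min nF≢0) inv with nF≢0⇒irreducible nF≢0
  ... | nF≡s , irreducible =
    subst (λ t → Invariant (G ++ [ t ]) (remove s C ++ pairsWith t (G ++ [ t ]))) (sym nF≡s)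
      (add-preserves s∈C s-min irreducible (subst (_≢ zeroV) nF≡s nF≢0) inv)

  run-preserves : ∀ {S T} → Star Step S T → uncurry Invariant S → uncurry Invariant T
  run-preserves ε inv = inv
  run-preserves (step ◅ steps) inv = run-preserves steps (step-preserves step inv)

lemma12 : (d m : ℕ) → (gens : Vec (Algorithm.Vn d m) d) →
    (∀ u v → InLattice gens u → InLattice gens v →
      Algorithm.π d m u ≡ Algorithm.π d m v → u ≡ v) →
    (Fbar : List (Algorithm.Vn d m)) →
    (∀ f → f ∈ Fbar → InLattice gens f) →
    (∀ w → (w ∈ map (Algorithm.π d m) Fbar →
              IsMinimalNonzero (Algorithm.InProjLattice d m gens) w)
         × (IsMinimalNonzero (Algorithm.InProjLattice d m gens) w →
              w ∈ map (Algorithm.π d m) Fbar)) →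
    (G : List (Algorithm.Vn d m)) →
    Algorithm.Returns d m Fbar G →
    ∀ v → (v ∈ G → IsGraver gens v) × (IsGraver gens v → v ∈ G)
lemma12 d m gens π-injective Fbar Fbar⊆Λ πFbar-minimal G returns v = graver , complete
  where
  open Algorithm d m using (norm)
  open Completion d m gens π-injective Fbar Fbar⊆Λ πFbar-minimal
  final : Invariant G []
  final = run-preserves returns initial-invariant
  open Invariant final
  open Criterion graver Fbar⊆G (invariant⇒reduced-below {N = suc (norm v)} final [])
  complete : IsGraver gens v → v ∈ G
  complete (Λv , v≢0 , v-minimal) with small⇒reducible Λv v≢0 ℕP.≤-refl
  ... | g , g∈G , g≼v with graver g∈G
  ...   | Λg , g≢0 , _ = subst (_∈ G) (v-minimal g Λg g≢0 (≼⇒⊑ g≼v)) g∈G
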